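{- (Completeness of the orthologic sequent calculus.) Let $(g,d)$ be a sequent of annotated orthologic terms. If for every ortholattice $(A,\le,\wedge,\vee,\neg,0,1)$ and every valuation $v$ from positive integers to $A$ we have $\iota_v(g)\le\neg\,\iota_v(d)$, then $(g,d)$ is derivable in the orthologic sequent calculus $\mathsf{OL}$.
   Context: Terms: generated from variables $x_p$ ($p$ a positive integer) by binary $\wedge$, binary $\vee$ and unary $\neg$. Annotated terms: $N$ (no formula), $L(t)$ ($t$ on the left), $R(t)$ ($t$ on the right). A sequent is an ordered pair $(g,d)$ of annotated terms. An ortholattice is a structure $(A,\wedge,\vee,\neg,0,1)$ satisfying, for all $x,y,z$: commutativity, associativity and idempotence of $\wedge$ and $\vee$; $x\vee 1=1$, $x\wedge 0=0$, $x\vee 0=x$, $x\wedge 1=x$; $\neg\neg x=x$; $x\vee\neg x=1$, $x\wedge\neg x=0$; $\neg(x\vee y)=\neg x\wedge\neg y$, $\neg(x\wedge y)=\neg x\vee\neg y$; $x\vee(x\wedge y)=x$, $x\wedge(x\vee y)=x$. Its order is $x\le y$ iff $x\wedge y=x$. For a valuation $v$, $\llbracket t\rrbracket_v$ is the evaluation of $t$ in $A$. Put $\iota_v(N)=1$, $\iota_v(L(t))=\llbracket t\rrbracket_v$, $\iota_v(R(t))=\neg\llbracket t\rrbracket_v$. Rules of $\mathsf{OL}$ (annotated terms $g,d$, terms $a,b$): Hyp: $(L(a),R(a))$. Weaken: from $(g,N)$ infer $(g,d)$. Contract: from $(g,g)$ infer $(g,N)$. Swap: from $(g,d)$ infer $(d,g)$.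 LeftAnd1/2: from $(L(a),d)$ (resp. $(L(b),d)$) infer $(L(a\wedge b),d)$. LeftOr: from $(L(a),d)$ and $(L(b),d)$ infer $(L(a\vee b),d)$. LeftNot: from $(R(a),d)$ infer $(L(\neg a),d)$. RightOr1/2: from $(g,R(a))$ (resp. $(g,R(b))$) infer $(g,R(a\vee b))$. RightAnd: from $(g,R(a))$ and $(g,R(b))$ infer $(g,R(a\wedge b))$. RightNot: from $(g,L(a))$ infer $(g,R(\neg a))$. Cut: from $(g,R(b))$ and $(L(b),d)$ infer $(g,d)$. -}

module Defs where

open import Data.Nat using (ℕ)
open import Relation.Binary.PropositionalEquality using (_≡_)

-- Terms: variables x_p (p a positive integer; constructor argument p : ℕ
-- encodes the variable x_(p+1)), binary ∧, binary ∨, unary ¬.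
data Term : Set where
  var  : ℕ → Term
  _∧ₜ_ : Term → Term → Term
  _∨ₜ_ : Term → Term → Term
  ¬ₜ_  : Term → Term

data Ann : Set where
  N : Ann
  L : Term → Ann
  R : Term → Ann

record Ortholattice : Set₁ where
  field
    Carrier : Set
    _∧_ : Carrier → Carrier → Carrier
    _∨_ : Carrier → Carrier → Carrier
    ¬_  : Carrier → Carrier
    𝟎 𝟏 : Carrier
    ∧-comm  : ∀ x y → (x ∧ y) ≡ (y ∧ x)
    ∨-comm  : ∀ x y → (x ∨ y) ≡ (y ∨ x)
    ∧-assoc : ∀ x y z → ((x ∧ y) ∧ z) ≡ (x ∧ (y ∧ z))
    ∨-assoc : ∀ x y z → ((x ∨ y) ∨ z) ≡ (x ∨ (y ∨ z))
    ∧-idem  : ∀ x → (x ∧ x) ≡ x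
    ∨-idem  : ∀ x → (x ∨ x) ≡ x
    ∨-one   : ∀ x → (x ∨ 𝟏) ≡ 𝟏
    ∧-zero  : ∀ x → (x ∧ 𝟎) ≡ 𝟎
    ∨-zero  : ∀ x → (x ∨ 𝟎) ≡ x
    ∧-one   : ∀ x → (x ∧ 𝟏) ≡ x
    ¬¬      : ∀ x → (¬ (¬ x)) ≡ x
    ∨-compl : ∀ x → (x ∨ (¬ x)) ≡ 𝟏
    ∧-compl : ∀ x → (x ∧ (¬ x)) ≡ 𝟎
    deMorgan-∨ : ∀ x y → (¬ (x ∨ y)) ≡ ((¬ x) ∧ (¬ y))
    deMorgan-∧ : ∀ x y → (¬ (x ∧ y)) ≡ ((¬ x) ∨ (¬ y))
    absorb-∨ : ∀ x y → (x ∨ (x ∧ y)) ≡ x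
    absorb-∧ : ∀ x y → (x ∧ (x ∨ y)) ≡ x

  _≤_ : Carrier → Carrier → Set
  x ≤ y = (x ∧ y) ≡ x

module _ (A : Ortholattice) where
  open Ortholattice A

  ⟦_⟧ : Term → (ℕ → Carrier) → Carrier
  ⟦ var p ⟧ v = v p
  ⟦ a ∧ₜ b ⟧ v = ⟦ a ⟧ v ∧ ⟦ b ⟧ v
  ⟦ a ∨ₜ b ⟧ v = ⟦ a ⟧ v ∨ ⟦ b ⟧ v
  ⟦ ¬ₜ a ⟧ v = ¬ (⟦ a ⟧ v)

  ι : (ℕ → Carrier) → Ann → Carrier
  ι v N = 𝟏
  ι v (L t) = ⟦ t ⟧ v
  ι v (R t) = ¬ (⟦ t ⟧ v)

data OL : Ann → Ann → Set where
  hyp       : ∀ a → OL (L a) (R a)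
  weaken    : ∀ {g} d → OL g N → OL g d
  contract  : ∀ {g} → OL g g → OL g N
  swap      : ∀ {g d} → OL g d → OL d g
  leftAnd1  : ∀ {a d} b → OL (L a) d → OL (L (a ∧ₜ b)) d
  leftAnd2  : ∀ {b d} a → OL (L b) d → OL (L (a ∧ₜ b)) d
  leftOr    : ∀ {a b d} → OL (L a) d → OL (L b) d → OL (L (a ∨ₜ b)) d
  leftNot   : ∀ {a d} → OL (R a) d → OL (L (¬ₜ a)) d
  rightOr1  : ∀ {g a} b → OL g (R a) → OL g (R (a ∨ₜ b))
  rightOr2  : ∀ {g b} a → OL g (R b) → OL g (R (a ∨ₜ b))
  rightAnd  : ∀ {g a b} → OL g (R a) → OL g (R b) → OL g (R (a ∧ₜ b))
  rightNot  : ∀ {g a} → OL g (L a) → OL g (R (¬ₜ a))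
  cut       : ∀ {g d} b → OL g (R b) → OL (L b) d → OL g d

{-# OPTIONS --safe #-}
-- Completeness goes through the Lindenbaum algebra of orthologic.  Terms are put in
-- negation normal form, and a one-sided cut-free sequent calculus on such formulas is
-- shown to admit cut (Gentzen's mix), so that X ⊑ Y, meaning ⊢ dual X, Y, is a preorder
-- whose quotient is an ortholattice.  Ortholattices here use propositional equality, so
-- the quotient is realised by canonical representatives: cut-free provability is decided
-- by a terminating proof search, and each class is represented by its first member in an
-- enumeration of all formulas.  Validity of (g , d) in this algebra under the generic
-- valuation x_p ↦ [x_p] yields a cut-free derivation of the one-sided form of the
-- sequent, which translates back into OL.
module Submission where

open import Defs
open import Axiom.UniquenessOfIdentityProofs.WithK using (uip)
open import Data.Empty using (⊥)
open import Data.List using (List; []; _∷_; _++_; cartesianProductWith; find)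
open import Data.List.Properties using (++-assoc; ++-identityʳ)
open import Data.List.Membership.Propositional using (_∈_; lose)
open import Data.List.Membership.Propositional.Properties
  using (∈-++⁺ˡ; ∈-++⁺ʳ; ∈-cartesianProductWith⁺)
open import Data.List.Relation.Unary.Any using (Any; here; there; tail)
open import Data.Maybe using (Maybe; just; nothing; fromMaybe)
open import Data.Nat using (ℕ; zero; suc; _≤_; _≤′_; ≤′-refl; ≤′-step)
import Data.Nat as ℕ
open import Data.Nat.Properties using (≤-total; ≤⇒≤′; m≤m⊔n; m≤n⊔m)
open import Data.Product using (Σ; ∃-syntax; _×_; _,_; proj₁; proj₂)
open import Data.Sum using (_⊎_; inj₁; inj₂; [_,_]′; map₁)
open import Function using (id; _⇔_; mk⇔; Equivalence)
open import Relation.Nullary using (Dec; yes; no; contradiction)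
open import Relation.Nullary.Decidable using (_⊎-dec_; _×-dec_; map′)
open import Relation.Unary using (Decidable)
open import Relation.Binary.PropositionalEquality
  using (_≡_; refl; sym; trans; cong; cong₂; subst; module ≡-Reasoning)

pair-or : ∀ {A B C : Set} → A ⊎ C → B ⊎ C → (A × B) ⊎ C
pair-or (inj₁ a) (inj₁ b) = inj₁ (a , b)
pair-or (inj₁ _) (inj₂ c) = inj₂ c
pair-or (inj₂ c) _        = inj₂ c

module _ {A : Set} {P : A → Set} (P? : Decidable P) where

  find-found : ∀ {xs} → Any P xs → ∃[ y ] find P? xs ≡ just y × P y
  find-found {x ∷ xs} any with P? x
  ... | yes px = x , refl , px
  ... | no ¬px = find-found (tail ¬px any)

  find-++ : ∀ {xs} ys → Any P xs → find P? (xs ++ ys) ≡ find P? xs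
  find-++ {x ∷ xs} ys any with P? x
  ... | yes _  = refl
  ... | no ¬px = find-++ ys (tail ¬px any)

  find-cong : ∀ {Q : A → Set} (Q? : Decidable Q) → (∀ {x} → P x ⇔ Q x) →
              ∀ xs → find P? xs ≡ find Q? xs
  find-cong Q? P⇔Q []       = refl
  find-cong Q? P⇔Q (x ∷ xs) with P? x | Q? x
  ... | yes _  | yes _  = refl
  ... | no _   | no _   = find-cong Q? P⇔Q xs
  ... | yes px | no ¬qx = contradiction (Equivalence.to P⇔Q px) ¬qx
  ... | no ¬px | yes qx = contradiction (Equivalence.from P⇔Q qx) ¬px

-- Negation normal forms and cut-free one-sided sequents

infixr 7 _⊓_
infixr 6 _⊔_

data NNF : Set where
  pos neg : ℕ → NNF
  _⊓_ _⊔_ : NNF → NNF → NNF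

dual : NNF → NNF
dual (pos p) = neg p
dual (neg p) = pos p
dual (A ⊓ B) = dual A ⊔ dual B
dual (A ⊔ B) = dual A ⊓ dual B

dual-involutive : ∀ X → dual (dual X) ≡ X
dual-involutive (pos p) = refl
dual-involutive (neg p) = refl
dual-involutive (A ⊓ B) = cong₂ _⊓_ (dual-involutive A) (dual-involutive B)
dual-involutive (A ⊔ B) = cong₂ _⊔_ (dual-involutive A) (dual-involutive B)

-- CutFree X nothing is the sequent ⊢ X and CutFree X (just Y) is ⊢ X, Y.
data CutFree : NNF → Maybe NNF → Set where
  ax    : ∀ p → CutFree (pos p) (just (neg p))
  exch  : ∀ {A B} → CutFree A (just B) → CutFree B (just A)
  weak  : ∀ {A B} → CutFree A nothing → CutFree A (just B)
  contr : ∀ {A} → CutFree A (just A) → CutFree A nothing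
  or₁   : ∀ {A B c} → CutFree A c → CutFree (A ⊔ B) c
  or₂   : ∀ {A B c} → CutFree B c → CutFree (A ⊔ B) c
  and   : ∀ {A B c} → CutFree A c → CutFree B c → CutFree (A ⊓ B) c

-- The sequent made of the formulas of both arguments; the empty sequent is underivable.
CutFreeJoin : Maybe NNF → Maybe NNF → Set
CutFreeJoin (just C) r       = CutFree C r
CutFreeJoin nothing (just E) = CutFree E nothing
CutFreeJoin nothing nothing  = ⊥

join-comm : ∀ r₁ r₂ → CutFreeJoin r₁ r₂ → CutFreeJoin r₂ r₁
join-comm (just C) (just E) d = exch d
join-comm (just C) nothing  d = d
join-comm nothing  (just E) d = d

weaken-by : ∀ r {P} → CutFree P nothing → CutFree P r
weaken-by (just E) d = weak d
weaken-by nothing  d = d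

join-weakenˡ : ∀ Q r → CutFreeJoin nothing r → CutFreeJoin (just Q) r
join-weakenˡ Q (just E) d = exch (weak d)

join-weakenʳ : ∀ c Q → CutFreeJoin c nothing → CutFreeJoin c (just Q)
join-weakenʳ (just C) Q d = weak d

join-contract : ∀ r → CutFreeJoin r r → CutFreeJoin r nothing
join-contract (just G) d = contr d
join-contract nothing  ()

join-or₁ : ∀ c {U V} → CutFreeJoin c (just U) → CutFreeJoin c (just (U ⊔ V))
join-or₁ c d = join-comm (just _) c (or₁ (join-comm c (just _) d))

join-or₂ : ∀ c {U V} → CutFreeJoin c (just V) → CutFreeJoin c (just (U ⊔ V))
join-or₂ c d = join-comm (just _) c (or₂ (join-comm c (just _) d))

join-and : ∀ c {U V} →
           CutFreeJoin c (just U) → CutFreeJoin c (just V) → CutFreeJoin c (just (U ⊓ V))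
join-and c d e = join-comm (just _) c (and (join-comm c (just _) d) (join-comm c (just _) e))

-- Cut admissibility

-- Occurrences A X c r: the sequent X, c is one or two copies of A together with r.
data Occurrences (A : NNF) : NNF → Maybe NNF → Maybe NNF → Set where
  first  : ∀ {c} → Occurrences A A c c
  second : ∀ {X} → Occurrences A X (just A) (just X)
  both   : Occurrences A A (just A) nothing

focus : ∀ {A X c r} → CutFree X c → Occurrences A X c r → CutFree A r
focus d first  = d
focus d second = exch d
focus d both   = contr d

data Principal : NNF → Maybe NNF → Set where
  prin-or₁ : ∀ {P Q c} → CutFree P c → Principal (P ⊔ Q) c
  prin-or₂ : ∀ {P Q c} → CutFree Q c → Principal (P ⊔ Q) c
  prin-and : ∀ {P Q c} → CutFree P c → CutFree Q c → Principal (P ⊓ Q) c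

-- Gentzen's mix: all occurrences of A on the left and of dual A on the right are cut at
-- once, so that contraction commutes with the cut.  Induction on A, then on the derivations.
mutual
  mix : ∀ A {X c Y e r₁ r₂} → CutFree X c → CutFree Y e →
        Occurrences A X c r₁ → Occurrences (dual A) Y e r₂ → CutFreeJoin r₁ r₂
  mix A (ax p)     d₂ first  o₂ = focus d₂ o₂
  mix A (ax p)     d₂ second o₂ = focus d₂ o₂
  mix A (exch d)   d₂ first  o₂ = mix A d d₂ second o₂
  mix A (exch d)   d₂ second o₂ = mix A d d₂ first o₂
  mix A (exch d)   d₂ both   o₂ = mix A d d₂ both o₂
  mix A (weak {B = Q} d) d₂ first o₂ = join-weakenˡ Q _ (mix A d d₂ first o₂)
  mix A (weak d)   d₂ second o₂ = weaken-by _ d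
  mix A (weak d)   d₂ both   o₂ = mix A d d₂ first o₂
  mix A (contr d)  d₂ first  o₂ = mix A d d₂ both o₂
  mix A (or₁ d)    d₂ first  o₂ = mix-principal A (prin-or₁ d) d₂ o₂
  mix A (or₁ d)    d₂ second o₂ = or₁ (mix A d d₂ second o₂)
  mix A (or₁ d)    d₂ both   o₂ =
    contract-principal A (prin-or₁ (mix A d d₂ second o₂)) d₂ o₂
  mix A (or₂ d)    d₂ first  o₂ = mix-principal A (prin-or₂ d) d₂ o₂
  mix A (or₂ d)    d₂ second o₂ = or₂ (mix A d d₂ second o₂)
  mix A (or₂ d)    d₂ both   o₂ =
    contract-principal A (prin-or₂ (mix A d d₂ second o₂)) d₂ o₂
  mix A (and d d′) d₂ first  o₂ = mix-principal A (prin-and d d′) d₂ o₂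
  mix A (and d d′) d₂ second o₂ = and (mix A d d₂ second o₂) (mix A d′ d₂ second o₂)
  mix A (and d d′) d₂ both   o₂ =
    contract-principal A (prin-and (mix A d d₂ second o₂) (mix A d′ d₂ second o₂)) d₂ o₂

  contract-principal : ∀ A {r Y e} → Principal A r → CutFree Y e →
                       Occurrences (dual A) Y e r → CutFreeJoin nothing r
  contract-principal A {r} π d₂ o₂ = join-comm r nothing (join-contract r (mix-principal A π d₂ o₂))

  mix-principal : ∀ A {c Y e r} → Principal A c → CutFree Y e →
                  Occurrences (dual A) Y e r → CutFreeJoin c r
  mix-principal (P ⊔ Q) π (ax p) ()
  mix-principal (P ⊓ Q) π (ax p) ()
  mix-principal A     π (exch d)   first  = mix-principal A π d second
  mix-principal A     π (exch d)   second = mix-principal A π d first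
  mix-principal A     π (exch d)   both   = mix-principal A π d both
  mix-principal A {c} π (weak d)   first  = join-weakenʳ c _ (mix-principal A π d first)
  mix-principal A {c} π (weak d)   second = join-comm (just _) c (weaken-by c d)
  mix-principal A     π (weak d)   both   = mix-principal A π d first
  mix-principal A     π (contr d)  first  = mix-principal A π d both
  mix-principal A {c} π (or₁ d)    second = join-or₁ c (mix-principal A π d second)
  mix-principal A {c} π (or₂ d)    second = join-or₂ c (mix-principal A π d second)
  mix-principal A {c} π (and d d′) second =
    join-and c (mix-principal A π d second) (mix-principal A π d′ second)
  mix-principal (P ⊔ Q) (prin-or₁ d₁)   (and d d′) first = mix P d₁ d first first
  mix-principal (P ⊔ Q) (prin-or₂ d₁)   (and d d′) first = mix Q d₁ d′ first first
  mix-principal (P ⊓ Q) (prin-and d₁ _) (or₁ d)    first = mix P d₁ d first first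
  mix-principal (P ⊓ Q) (prin-and _ d₁) (or₂ d)    first = mix Q d₁ d first first
  mix-principal (P ⊔ Q) {c} π@(prin-or₁ d₁)   (and d d′) both =
    mix-contract P c d₁ (mix-principal (P ⊔ Q) π d second)
  mix-principal (P ⊔ Q) {c} π@(prin-or₂ d₁)   (and d d′) both =
    mix-contract Q c d₁ (mix-principal (P ⊔ Q) π d′ second)
  mix-principal (P ⊓ Q) {c} π@(prin-and d₁ _) (or₁ d)    both =
    mix-contract P c d₁ (mix-principal (P ⊓ Q) π d second)
  mix-principal (P ⊓ Q) {c} π@(prin-and _ d₁) (or₂ d)    both =
    mix-contract Q c d₁ (mix-principal (P ⊓ Q) π d second)

  mix-contract : ∀ P c → CutFree P c → CutFreeJoin c (just (dual P)) → CutFreeJoin c nothing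
  mix-contract P c d₁ d₂ = join-contract c (mix P d₁ (join-comm c (just (dual P)) d₂) first first)

cut-admissible : ∀ A {c e} → CutFree A c → CutFree (dual A) e → CutFreeJoin c e
cut-admissible A d e = mix A d e first first

-- Decidability of cut-free provability

Complementary : NNF → NNF → Set
Complementary (pos p) (neg q) = p ≡ q
Complementary (neg p) (pos q) = p ≡ q
Complementary _       _       = ⊥

complementary? : ∀ P Q → Dec (Complementary P Q)
complementary? (pos p) (neg q) = p ℕ.≟ q
complementary? (neg p) (pos q) = p ℕ.≟ q
complementary? (pos p) (pos q) = no λ ()
complementary? (pos p) (_ ⊓ _) = no λ ()
complementary? (pos p) (_ ⊔ _) = no λ ()
complementary? (neg p) (neg q) = no λ ()
complementary? (neg p) (_ ⊓ _) = no λ ()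
complementary? (neg p) (_ ⊔ _) = no λ ()
complementary? (_ ⊓ _) _       = no λ ()
complementary? (_ ⊔ _) _       = no λ ()

complementary-sym : ∀ P Q → Complementary P Q → Complementary Q P
complementary-sym (pos p) (neg q) = sym
complementary-sym (neg p) (pos q) = sym

complementary-sound : ∀ P Q → Complementary P Q → CutFree P (just Q)
complementary-sound (pos p) (neg .p) refl = ax p
complementary-sound (neg p) (pos .p) refl = exch (ax p)

-- Proof search for CutFree, read off its rules backwards.  In Analytic₁ X a contraction
-- ⊢ X, X is only tried after an introduction on the first copy, and Analytic₂⁻ P Q is
-- ⊢ P, Q without a final weakening by Q; both restrictions make the search terminate.
mutual
  Analytic₁ : NNF → Set
  Analytic₁ X = Intro₁ X ⊎ LeftIntro X X

  Intro₁ : NNF → Set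
  Intro₁ (A ⊔ B) = Analytic₁ A ⊎ Analytic₁ B
  Intro₁ (A ⊓ B) = Analytic₁ A × Analytic₁ B
  Intro₁ (pos p) = ⊥
  Intro₁ (neg p) = ⊥

  LeftIntro : NNF → NNF → Set
  LeftIntro (A ⊔ B) Q = Analytic₂⁻ A Q ⊎ Analytic₂⁻ B Q
  LeftIntro (A ⊓ B) Q = Analytic₂⁻ A Q × Analytic₂⁻ B Q
  LeftIntro (pos p) Q = ⊥
  LeftIntro (neg p) Q = ⊥

  RightIntro : NNF → NNF → Set
  RightIntro P (A ⊔ B) = Analytic₂ P A ⊎ Analytic₂ P B
  RightIntro P (A ⊓ B) = Analytic₂ P A × Analytic₂ P B
  RightIntro P (pos p) = ⊥
  RightIntro P (neg p) = ⊥

  Analytic₂⁻ : NNF → NNF → Set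
  Analytic₂⁻ P Q = Complementary P Q ⊎ LeftIntro P Q ⊎ RightIntro P Q ⊎ Analytic₁ P

  Analytic₂ : NNF → NNF → Set
  Analytic₂ P Q = Analytic₂⁻ P Q ⊎ Analytic₁ Q

pattern complementary c = inj₁ c
pattern leftIntro i     = inj₂ (inj₁ i)
pattern rightIntro i    = inj₂ (inj₂ (inj₁ i))
pattern weakening s     = inj₂ (inj₂ (inj₂ s))

mutual
  analytic₁? : ∀ X → Dec (Analytic₁ X)
  analytic₁? X = intro₁? X ⊎-dec leftIntro? X X

  intro₁? : ∀ X → Dec (Intro₁ X)
  intro₁? (A ⊔ B) = analytic₁? A ⊎-dec analytic₁? B
  intro₁? (A ⊓ B) = analytic₁? A ×-dec analytic₁? B
  intro₁? (pos p) = no λ ()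
  intro₁? (neg p) = no λ ()

  leftIntro? : ∀ P Q → Dec (LeftIntro P Q)
  leftIntro? (A ⊔ B) Q = analytic₂⁻? A Q ⊎-dec analytic₂⁻? B Q
  leftIntro? (A ⊓ B) Q = analytic₂⁻? A Q ×-dec analytic₂⁻? B Q
  leftIntro? (pos p) Q = no λ ()
  leftIntro? (neg p) Q = no λ ()

  rightIntro? : ∀ P Q → Dec (RightIntro P Q)
  rightIntro? P (A ⊔ B) = analytic₂? P A ⊎-dec analytic₂? P B
  rightIntro? P (A ⊓ B) = analytic₂? P A ×-dec analytic₂? P B
  rightIntro? P (pos p) = no λ ()
  rightIntro? P (neg p) = no λ ()

  analytic₂⁻? : ∀ P Q → Dec (Analytic₂⁻ P Q)
  analytic₂⁻? P Q = complementary? P Q ⊎-dec leftIntro? P Q ⊎-dec rightIntro? P Q ⊎-dec analytic₁? P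

  analytic₂? : ∀ P Q → Dec (Analytic₂ P Q)
  analytic₂? P Q = analytic₂⁻? P Q ⊎-dec analytic₁? Q

mutual
  analytic₁-sound : ∀ X → Analytic₁ X → CutFree X nothing
  analytic₁-sound X (inj₁ i) = intro₁-sound X i
  analytic₁-sound X (inj₂ i) = contr (leftIntro-sound X X i)

  intro₁-sound : ∀ X → Intro₁ X → CutFree X nothing
  intro₁-sound (A ⊔ B) (inj₁ a)  = or₁ (analytic₁-sound A a)
  intro₁-sound (A ⊔ B) (inj₂ b)  = or₂ (analytic₁-sound B b)
  intro₁-sound (A ⊓ B) (a , b)   = and (analytic₁-sound A a) (analytic₁-sound B b)

  leftIntro-sound : ∀ P Q → LeftIntro P Q → CutFree P (just Q)
  leftIntro-sound (A ⊔ B) Q (inj₁ a) = or₁ (analytic₂⁻-sound A Q a)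
  leftIntro-sound (A ⊔ B) Q (inj₂ b) = or₂ (analytic₂⁻-sound B Q b)
  leftIntro-sound (A ⊓ B) Q (a , b)  = and (analytic₂⁻-sound A Q a) (analytic₂⁻-sound B Q b)

  rightIntro-sound : ∀ P Q → RightIntro P Q → CutFree P (just Q)
  rightIntro-sound P (A ⊔ B) (inj₁ a) = exch (or₁ (exch (analytic₂-sound P A a)))
  rightIntro-sound P (A ⊔ B) (inj₂ b) = exch (or₂ (exch (analytic₂-sound P B b)))
  rightIntro-sound P (A ⊓ B) (a , b)  =
    exch (and (exch (analytic₂-sound P A a)) (exch (analytic₂-sound P B b)))

  analytic₂⁻-sound : ∀ P Q → Analytic₂⁻ P Q → CutFree P (just Q)
  analytic₂⁻-sound P Q (complementary c) = complementary-sound P Q c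
  analytic₂⁻-sound P Q (leftIntro i)     = leftIntro-sound P Q i
  analytic₂⁻-sound P Q (rightIntro i)    = rightIntro-sound P Q i
  analytic₂⁻-sound P Q (weakening s)     = weak (analytic₁-sound P s)

  analytic₂-sound : ∀ P Q → Analytic₂ P Q → CutFree P (just Q)
  analytic₂-sound P Q (inj₁ a) = analytic₂⁻-sound P Q a
  analytic₂-sound P Q (inj₂ s) = exch (weak (analytic₁-sound Q s))

mutual
  analytic₂-sym : ∀ P Q → Analytic₂ P Q → Analytic₂ Q P
  analytic₂-sym P Q (inj₁ a) = analytic₂⁻-sym P Q a
  analytic₂-sym P Q (inj₂ s) = inj₁ (weakening s)

  analytic₂⁻-sym : ∀ P Q → Analytic₂⁻ P Q → Analytic₂ Q P
  analytic₂⁻-sym P Q (complementary c) = inj₁ (complementary (complementary-sym P Q c))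
  analytic₂⁻-sym P Q (leftIntro i)     = inj₁ (rightIntro (leftIntro-sym P Q i))
  analytic₂⁻-sym P Q (rightIntro i)    = map₁ (λ j → leftIntro j) (rightIntro-sym P Q i)
  analytic₂⁻-sym P Q (weakening s)     = inj₂ s

  leftIntro-sym : ∀ P Q → LeftIntro P Q → RightIntro Q P
  leftIntro-sym (A ⊔ B) Q (inj₁ a) = inj₁ (analytic₂⁻-sym A Q a)
  leftIntro-sym (A ⊔ B) Q (inj₂ b) = inj₂ (analytic₂⁻-sym B Q b)
  leftIntro-sym (A ⊓ B) Q (a , b)  = analytic₂⁻-sym A Q a , analytic₂⁻-sym B Q b

  rightIntro-sym : ∀ P Q → RightIntro P Q → LeftIntro Q P ⊎ Analytic₁ P
  rightIntro-sym P (A ⊔ B) (inj₁ a) = map₁ inj₁ (analytic₂-sym P A a)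
  rightIntro-sym P (A ⊔ B) (inj₂ b) = map₁ inj₂ (analytic₂-sym P B b)
  rightIntro-sym P (A ⊓ B) (a , b)  = pair-or (analytic₂-sym P A a) (analytic₂-sym P B b)

analytic₂-contract : ∀ X → Analytic₂ X X → Analytic₁ X
analytic₂-contract X       (inj₂ s)                   = s
analytic₂-contract X       (inj₁ (leftIntro i))       = inj₂ i
analytic₂-contract X       (inj₁ (rightIntro i))      = [ inj₂ , id ]′ (rightIntro-sym X X i)
analytic₂-contract X       (inj₁ (weakening s))       = s
analytic₂-contract (pos p) (inj₁ (complementary ()))
analytic₂-contract (neg p) (inj₁ (complementary ()))
analytic₂-contract (A ⊓ B) (inj₁ (complementary ()))
analytic₂-contract (A ⊔ B) (inj₁ (complementary ()))

mutual
  analytic₁-complete : ∀ {X} → CutFree X nothing → Analytic₁ X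
  analytic₁-complete (contr {A} d) = analytic₂-contract A (analytic₂-complete d)
  analytic₁-complete (or₁ d)       = inj₁ (inj₁ (analytic₁-complete d))
  analytic₁-complete (or₂ d)       = inj₁ (inj₂ (analytic₁-complete d))
  analytic₁-complete (and d e)     = inj₁ (analytic₁-complete d , analytic₁-complete e)

  analytic₂-complete : ∀ {P Q} → CutFree P (just Q) → Analytic₂ P Q
  analytic₂-complete (ax p)          = inj₁ (complementary refl)
  analytic₂-complete (exch {A} {B} d) = analytic₂-sym A B (analytic₂-complete d)
  analytic₂-complete (weak d)        = inj₁ (weakening (analytic₁-complete d))
  analytic₂-complete (or₁ d)         = map₁ (λ a → leftIntro (inj₁ a)) (analytic₂-complete d)
  analytic₂-complete (or₂ d)         = map₁ (λ b → leftIntro (inj₂ b)) (analytic₂-complete d)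
  analytic₂-complete (and d e)       =
    map₁ (λ ab → leftIntro ab) (pair-or (analytic₂-complete d) (analytic₂-complete e))

-- The Lindenbaum algebra

identity : ∀ X → CutFree X (just (dual X))
identity (pos p) = ax p
identity (neg p) = exch (ax p)
identity (A ⊓ B) = and (exch (or₁ (exch (identity A)))) (exch (or₂ (exch (identity B))))
identity (A ⊔ B) = exch (and (exch (or₁ (identity A))) (exch (or₂ (identity B))))

excluded-middle : ∀ X → CutFree (X ⊔ dual X) nothing
excluded-middle X = contr (or₁ (exch (or₂ (exch (identity X)))))

-- Any instance of excluded middle serves as the top element.
top bot : NNF
top = pos 0 ⊔ neg 0
bot = dual top

infix 4 _⊑_ _≋_

record _⊑_ (X Y : NNF) : Set where
  constructor ⟨_⟩
  field derivation : CutFree (dual X) (just Y)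

_≋_ : NNF → NNF → Set
X ≋ Y = X ⊑ Y × Y ⊑ X

_⊑?_ : ∀ X Y → Dec (X ⊑ Y)
X ⊑? Y = map′ (λ a → ⟨ analytic₂-sound (dual X) Y a ⟩) (λ (⟨ d ⟩) → analytic₂-complete d)
              (analytic₂? (dual X) Y)

_≋?_ : ∀ X Y → Dec (X ≋ Y)
X ≋? Y = X ⊑? Y ×-dec Y ⊑? X

identity′ : ∀ X → CutFree (dual X) (just X)
identity′ X = subst (λ Z → CutFree (dual X) (just Z)) (dual-involutive X) (identity (dual X))

⊑-refl : ∀ X → X ⊑ X
⊑-refl X = ⟨ identity′ X ⟩

⊑-trans : ∀ {X Y Z} → X ⊑ Y → Y ⊑ Z → X ⊑ Z
⊑-trans {Y = Y} ⟨ d ⟩ ⟨ e ⟩ = ⟨ cut-admissible Y (exch d) e ⟩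

⊓⊑ˡ : ∀ {X Y} → X ⊓ Y ⊑ X
⊓⊑ˡ {X} = ⟨ or₁ (identity′ X) ⟩

⊓⊑ʳ : ∀ {X Y} → X ⊓ Y ⊑ Y
⊓⊑ʳ {Y = Y} = ⟨ or₂ (identity′ Y) ⟩

⊓-greatest : ∀ {X Y Z} → Z ⊑ X → Z ⊑ Y → Z ⊑ X ⊓ Y
⊓-greatest ⟨ d ⟩ ⟨ e ⟩ = ⟨ exch (and (exch d) (exch e)) ⟩

⊑⊔ˡ : ∀ {X Y} → X ⊑ X ⊔ Y
⊑⊔ˡ {X} = ⟨ exch (or₁ (exch (identity′ X))) ⟩

⊑⊔ʳ : ∀ {X Y} → Y ⊑ X ⊔ Y
⊑⊔ʳ {Y = Y} = ⟨ exch (or₂ (exch (identity′ Y))) ⟩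

⊔-least : ∀ {X Y Z} → X ⊑ Z → Y ⊑ Z → X ⊔ Y ⊑ Z
⊔-least ⟨ d ⟩ ⟨ e ⟩ = ⟨ and d e ⟩

⊑-top : ∀ {X} → X ⊑ top
⊑-top = ⟨ exch (weak (excluded-middle (pos 0))) ⟩

bot-⊑ : ∀ {X} → bot ⊑ X
bot-⊑ = ⟨ weak (excluded-middle (pos 0)) ⟩

dual-antitone : ∀ {X Y} → X ⊑ Y → dual Y ⊑ dual X
dual-antitone {X} {Y} ⟨ d ⟩ =
  ⟨ subst (λ Z → CutFree Z (just (dual X))) (sym (dual-involutive Y)) (exch d) ⟩

infixr 5 _∙_

≋-refl : ∀ {X} → X ≋ X
≋-refl {X} = ⊑-refl X , ⊑-refl X

≋-sym : ∀ {X Y} → X ≋ Y → Y ≋ X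
≋-sym (X⊑Y , Y⊑X) = Y⊑X , X⊑Y

_∙_ : ∀ {X Y Z} → X ≋ Y → Y ≋ Z → X ≋ Z
(X⊑Y , Y⊑X) ∙ (Y⊑Z , Z⊑Y) = ⊑-trans X⊑Y Y⊑Z , ⊑-trans Z⊑Y Y⊑X

≡⇒≋ : ∀ {X Y} → X ≡ Y → X ≋ Y
≡⇒≋ refl = ≋-refl

⊓-cong : ∀ {X X′ Y Y′} → X ≋ X′ → Y ≋ Y′ → X ⊓ Y ≋ X′ ⊓ Y′
⊓-cong (X⊑ , ⊒X) (Y⊑ , ⊒Y) =
  ⊓-greatest (⊑-trans ⊓⊑ˡ X⊑) (⊑-trans ⊓⊑ʳ Y⊑) , ⊓-greatest (⊑-trans ⊓⊑ˡ ⊒X) (⊑-trans ⊓⊑ʳ ⊒Y)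

⊔-cong : ∀ {X X′ Y Y′} → X ≋ X′ → Y ≋ Y′ → X ⊔ Y ≋ X′ ⊔ Y′
⊔-cong (X⊑ , ⊒X) (Y⊑ , ⊒Y) =
  ⊔-least (⊑-trans X⊑ ⊑⊔ˡ) (⊑-trans Y⊑ ⊑⊔ʳ) , ⊔-least (⊑-trans ⊒X ⊑⊔ˡ) (⊑-trans ⊒Y ⊑⊔ʳ)

dual-cong : ∀ {X Y} → X ≋ Y → dual X ≋ dual Y
dual-cong (X⊑Y , Y⊑X) = dual-antitone Y⊑X , dual-antitone X⊑Y

⊓-comm : ∀ {X Y} → X ⊓ Y ≋ Y ⊓ X
⊓-comm = ⊓-greatest ⊓⊑ʳ ⊓⊑ˡ , ⊓-greatest ⊓⊑ʳ ⊓⊑ˡ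

⊔-comm : ∀ {X Y} → X ⊔ Y ≋ Y ⊔ X
⊔-comm = ⊔-least ⊑⊔ʳ ⊑⊔ˡ , ⊔-least ⊑⊔ʳ ⊑⊔ˡ

⊓-assoc : ∀ {X Y Z} → (X ⊓ Y) ⊓ Z ≋ X ⊓ (Y ⊓ Z)
⊓-assoc = ⊓-greatest (⊑-trans ⊓⊑ˡ ⊓⊑ˡ) (⊓-greatest (⊑-trans ⊓⊑ˡ ⊓⊑ʳ) ⊓⊑ʳ)
        , ⊓-greatest (⊓-greatest ⊓⊑ˡ (⊑-trans ⊓⊑ʳ ⊓⊑ˡ)) (⊑-trans ⊓⊑ʳ ⊓⊑ʳ)

⊔-assoc : ∀ {X Y Z} → (X ⊔ Y) ⊔ Z ≋ X ⊔ (Y ⊔ Z)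
⊔-assoc = ⊔-least (⊔-least ⊑⊔ˡ (⊑-trans ⊑⊔ˡ ⊑⊔ʳ)) (⊑-trans ⊑⊔ʳ ⊑⊔ʳ)
        , ⊔-least (⊑-trans ⊑⊔ˡ ⊑⊔ˡ) (⊔-least (⊑-trans ⊑⊔ʳ ⊑⊔ˡ) ⊑⊔ʳ)

⊓-idem : ∀ {X} → X ⊓ X ≋ X
⊓-idem {X} = ⊓⊑ˡ , ⊓-greatest (⊑-refl X) (⊑-refl X)

⊔-idem : ∀ {X} → X ⊔ X ≋ X
⊔-idem {X} = ⊔-least (⊑-refl X) (⊑-refl X) , ⊑⊔ˡ

⊔-top : ∀ {X} → X ⊔ top ≋ top
⊔-top = ⊑-top , ⊑⊔ʳ

⊓-bot : ∀ {X} → X ⊓ bot ≋ bot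
⊓-bot = ⊓⊑ʳ , bot-⊑

⊔-bot : ∀ {X} → X ⊔ bot ≋ X
⊔-bot {X} = ⊔-least (⊑-refl X) bot-⊑ , ⊑⊔ˡ

⊓-top : ∀ {X} → X ⊓ top ≋ X
⊓-top {X} = ⊓⊑ˡ , ⊓-greatest (⊑-refl X) ⊑-top

⊔-dual : ∀ {X} → X ⊔ dual X ≋ top
⊔-dual {X} = ⊑-top , ⟨ exch (weak (excluded-middle X)) ⟩

⊓-dual : ∀ {X} → X ⊓ dual X ≋ bot
⊓-dual {X} = ⟨ weak (excluded-middle (dual X)) ⟩ , bot-⊑

⊔-absorbs-⊓ : ∀ {X Y} → X ⊔ (X ⊓ Y) ≋ X
⊔-absorbs-⊓ {X} = ⊔-least (⊑-refl X) ⊓⊑ˡ , ⊑⊔ˡ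

⊓-absorbs-⊔ : ∀ {X Y} → X ⊓ (X ⊔ Y) ≋ X
⊓-absorbs-⊔ {X} = ⊓⊑ˡ , ⊓-greatest (⊑-refl X) ⊑⊔ˡ

rank : NNF → ℕ
rank (pos p) = suc p
rank (neg p) = suc p
rank (A ⊓ B) = suc (rank A ℕ.⊔ rank B)
rank (A ⊔ B) = suc (rank A ℕ.⊔ rank B)

mutual
  formulas : ℕ → List NNF
  formulas zero    = []
  formulas (suc k) = formulas k ++ layer k

  layer : ℕ → List NNF
  layer k = pos k ∷ neg k ∷ cartesianProductWith _⊓_ (formulas k) (formulas k)
                            ++ cartesianProductWith _⊔_ (formulas k) (formulas k)

formulas-extends : ∀ {k k′} → k ≤′ k′ → ∃[ r ] formulas k′ ≡ formulas k ++ r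
formulas-extends ≤′-refl = [] , sym (++-identityʳ _)
formulas-extends (≤′-step {n} k≤n) with r , eq ← formulas-extends k≤n =
  r ++ layer n , trans (cong (_++ layer n) eq) (++-assoc _ r (layer n))

formulas-mono : ∀ {k k′ X} → k ≤ k′ → X ∈ formulas k → X ∈ formulas k′
formulas-mono k≤k′ X∈ with r , eq ← formulas-extends (≤⇒≤′ k≤k′) =
  subst (_ ∈_) (sym eq) (∈-++⁺ˡ X∈)

∈-formulas : ∀ X → X ∈ formulas (rank X)
∈-formulas (pos p) = ∈-++⁺ʳ (formulas p) (here refl)
∈-formulas (neg p) = ∈-++⁺ʳ (formulas p) (there (here refl))
∈-formulas (A ⊓ B) = ∈-++⁺ʳ (formulas (rank A ℕ.⊔ rank B)) (there (there (∈-++⁺ˡ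
  (∈-cartesianProductWith⁺ _⊓_ (formulas-mono (m≤m⊔n (rank A) (rank B)) (∈-formulas A))
                               (formulas-mono (m≤n⊔m (rank A) (rank B)) (∈-formulas B))))))
∈-formulas (A ⊔ B) = ∈-++⁺ʳ (formulas k) (there (there
  (∈-++⁺ʳ (cartesianProductWith _⊓_ (formulas k) (formulas k))
    (∈-cartesianProductWith⁺ _⊔_ (formulas-mono (m≤m⊔n (rank A) (rank B)) (∈-formulas A))
                                 (formulas-mono (m≤n⊔m (rank A) (rank B)) (∈-formulas B))))))
  where k = rank A ℕ.⊔ rank B

search : NNF → ℕ → Maybe NNF
search X k = find (_≋? X) (formulas k)

search-found : ∀ X → ∃[ Y ] search X (rank X) ≡ just Y × Y ≋ X
search-found X = find-found (_≋? X) (lose (∈-formulas X) ≋-refl)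

search-stable : ∀ {X X′} → rank X ≤ rank X′ → X ≋ X′ → search X′ (rank X′) ≡ search X (rank X)
search-stable {X} {X′} le X≋X′ with r , eq ← formulas-extends (≤⇒≤′ le) = begin
  find (_≋? X′) (formulas (rank X′))      ≡⟨ cong (find (_≋? X′)) eq ⟩
  find (_≋? X′) (formulas (rank X) ++ r)  ≡⟨ find-++ (_≋? X′) r (lose (∈-formulas X) X≋X′) ⟩
  find (_≋? X′) (formulas (rank X))       ≡⟨ find-cong (_≋? X′) (_≋? X) same (formulas (rank X)) ⟩
  find (_≋? X) (formulas (rank X))        ∎
  where
  open ≡-Reasoning
  same : ∀ {Y} → Y ≋ X′ ⇔ Y ≋ X
  same = mk⇔ (_∙ ≋-sym X≋X′) (_∙ X≋X′)

-- Opaque so that unification can read X and Y off a goal [ X ] ≡ [ Y ] below.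
opaque
  -- The default X is never used, since X occurs in formulas (rank X).
  canon : NNF → NNF
  canon X = fromMaybe X (search X (rank X))

  canon-≋ : ∀ X → canon X ≋ X
  canon-≋ X with Y , eq , Y≋X ← search-found X = subst (_≋ X) (sym (cong (fromMaybe X) eq)) Y≋X

  canon-cong≤ : ∀ {X X′} → rank X ≤ rank X′ → X ≋ X′ → canon X ≡ canon X′
  canon-cong≤ {X} {X′} le X≋X′ with Y , eq , _ ← search-found X =
    trans (cong (fromMaybe X) eq) (sym (cong (fromMaybe X′) (trans (search-stable le X≋X′) eq)))

canon-cong : ∀ {X X′} → X ≋ X′ → canon X ≡ canon X′
canon-cong {X} {X′} X≋X′ with ≤-total (rank X) (rank X′)
... | inj₁ le = canon-cong≤ le X≋X′
... | inj₂ le = sym (canon-cong≤ le (≋-sym X≋X′))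

canon-idem : ∀ X → canon (canon X) ≡ canon X
canon-idem X = canon-cong (canon-≋ X)

Canonical : Set
Canonical = Σ NNF λ X → canon X ≡ X

⌊_⌋ : Canonical → NNF
⌊_⌋ = proj₁

[_] : NNF → Canonical
[ X ] = canon X , canon-idem X

canonical-≡ : {a b : Canonical} → ⌊ a ⌋ ≡ ⌊ b ⌋ → a ≡ b
canonical-≡ {X , p} {.X , q} refl = cong (X ,_) (uip p q)

[]-cong : ∀ {X Y} → X ≋ Y → [ X ] ≡ [ Y ]
[]-cong X≋Y = canonical-≡ (canon-cong X≋Y)

[]-⌊⌋ : ∀ {X} (a : Canonical) → X ≋ ⌊ a ⌋ → [ X ] ≡ a
[]-⌊⌋ (Y , canonical) X≋Y = canonical-≡ (trans (canon-cong X≋Y) canonical)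

Lindenbaum : Ortholattice
Lindenbaum = record
  { Carrier    = Canonical
  ; _∧_        = λ a b → [ ⌊ a ⌋ ⊓ ⌊ b ⌋ ]
  ; _∨_        = λ a b → [ ⌊ a ⌋ ⊔ ⌊ b ⌋ ]
  ; ¬_         = λ a → [ dual ⌊ a ⌋ ]
  ; 𝟎          = [ bot ]
  ; 𝟏          = [ top ]
  ; ∧-comm     = λ _ _ → []-cong ⊓-comm
  ; ∨-comm     = λ _ _ → []-cong ⊔-comm
  ; ∧-assoc    = λ _ _ _ →
      []-cong (⊓-cong (canon-≋ _) ≋-refl ∙ ⊓-assoc ∙ ⊓-cong ≋-refl (≋-sym (canon-≋ _)))
  ; ∨-assoc    = λ _ _ _ →
      []-cong (⊔-cong (canon-≋ _) ≋-refl ∙ ⊔-assoc ∙ ⊔-cong ≋-refl (≋-sym (canon-≋ _)))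
  ; ∧-idem     = λ a → []-⌊⌋ a ⊓-idem
  ; ∨-idem     = λ a → []-⌊⌋ a ⊔-idem
  ; ∨-one      = λ _ → []-cong (⊔-cong ≋-refl (canon-≋ _) ∙ ⊔-top)
  ; ∧-zero     = λ _ → []-cong (⊓-cong ≋-refl (canon-≋ _) ∙ ⊓-bot)
  ; ∨-zero     = λ a → []-⌊⌋ a (⊔-cong ≋-refl (canon-≋ _) ∙ ⊔-bot)
  ; ∧-one      = λ a → []-⌊⌋ a (⊓-cong ≋-refl (canon-≋ _) ∙ ⊓-top)
  ; ¬¬         = λ a → []-⌊⌋ a (dual-cong (canon-≋ _) ∙ ≡⇒≋ (dual-involutive _))
  ; ∨-compl    = λ _ → []-cong (⊔-cong ≋-refl (canon-≋ _) ∙ ⊔-dual)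
  ; ∧-compl    = λ _ → []-cong (⊓-cong ≋-refl (canon-≋ _) ∙ ⊓-dual)
  ; deMorgan-∨ = λ _ _ → []-cong (dual-cong (canon-≋ _) ∙ ≋-sym (⊓-cong (canon-≋ _) (canon-≋ _)))
  ; deMorgan-∧ = λ _ _ → []-cong (dual-cong (canon-≋ _) ∙ ≋-sym (⊔-cong (canon-≋ _) (canon-≋ _)))
  ; absorb-∨   = λ a _ → []-⌊⌋ a (⊔-cong ≋-refl (canon-≋ _) ∙ ⊔-absorbs-⊓)
  ; absorb-∧   = λ a _ → []-⌊⌋ a (⊓-cong ≋-refl (canon-≋ _) ∙ ⊓-absorbs-⊔)
  }

toNNF : Term → NNF
toNNF (var p)  = pos p
toNNF (a ∧ₜ b) = toNNF a ⊓ toNNF b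
toNNF (a ∨ₜ b) = toNNF a ⊔ toNNF b
toNNF (¬ₜ a)   = dual (toNNF a)

toTerm : NNF → Term
toTerm (pos p) = var p
toTerm (neg p) = ¬ₜ var p
toTerm (A ⊓ B) = toTerm A ∧ₜ toTerm B
toTerm (A ⊔ B) = toTerm A ∨ₜ toTerm B

asRight : Maybe NNF → Ann
asRight nothing  = N
asRight (just X) = R (toTerm X)

CutFree⇒OL : ∀ {X c} → CutFree X c → OL (R (toTerm X)) (asRight c)
CutFree⇒OL (ax p)          = rightNot (swap (hyp (var p)))
CutFree⇒OL (exch d)        = swap (CutFree⇒OL d)
CutFree⇒OL (weak d)        = weaken _ (CutFree⇒OL d)
CutFree⇒OL (contr d)       = contract (CutFree⇒OL d)
CutFree⇒OL (or₁ {B = B} d) = swap (rightOr1 (toTerm B) (swap (CutFree⇒OL d)))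
CutFree⇒OL (or₂ {A = A} d) = swap (rightOr2 (toTerm A) (swap (CutFree⇒OL d)))
CutFree⇒OL (and d e)       = swap (rightAnd (swap (CutFree⇒OL d)) (swap (CutFree⇒OL e)))

CutFreeJoin⇒OL : ∀ r₁ r₂ → CutFreeJoin r₁ r₂ → OL (asRight r₁) (asRight r₂)
CutFreeJoin⇒OL (just C) r        d = CutFree⇒OL d
CutFreeJoin⇒OL nothing  (just E) d = swap (CutFree⇒OL d)

mutual
  dual-inconsistent : ∀ X → OL (L (toTerm (dual X))) (L (toTerm X))
  dual-inconsistent (pos p) = leftNot (swap (hyp (var p)))
  dual-inconsistent (neg p) = swap (leftNot (swap (hyp (var p))))
  dual-inconsistent (A ⊓ B) =
    leftOr (swap (leftAnd1 _ (swap (dual-inconsistent A))))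
           (swap (leftAnd2 _ (swap (dual-inconsistent B))))
  dual-inconsistent (A ⊔ B) =
    swap (leftOr (swap (leftAnd1 _ (dual-inconsistent A)))
                 (swap (leftAnd2 _ (dual-inconsistent B))))

  dual-exhaustive : ∀ X → OL (R (toTerm (dual X))) (R (toTerm X))
  dual-exhaustive (pos p) = swap (rightNot (swap (hyp (var p))))
  dual-exhaustive (neg p) = rightNot (swap (hyp (var p)))
  dual-exhaustive (A ⊓ B) =
    rightAnd (swap (rightOr1 _ (swap (dual-exhaustive A))))
             (swap (rightOr2 _ (swap (dual-exhaustive B))))
  dual-exhaustive (A ⊔ B) =
    swap (rightAnd (swap (rightOr1 _ (dual-exhaustive A))) (swap (rightOr2 _ (dual-exhaustive B))))

mutual
  entails-toNNF : ∀ t → OL (L t) (R (toTerm (toNNF t)))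
  entails-toNNF (var p)  = hyp (var p)
  entails-toNNF (a ∧ₜ b) = rightAnd (leftAnd1 b (entails-toNNF a)) (leftAnd2 a (entails-toNNF b))
  entails-toNNF (a ∨ₜ b) = leftOr (rightOr1 _ (entails-toNNF a)) (rightOr2 _ (entails-toNNF b))
  entails-toNNF (¬ₜ a)   =
    leftNot (swap (cut (toTerm (toNNF a)) (dual-exhaustive (toNNF a)) (toNNF-entails a)))

  toNNF-entails : ∀ t → OL (L (toTerm (toNNF t))) (R t)
  toNNF-entails (var p)  = hyp (var p)
  toNNF-entails (a ∧ₜ b) = rightAnd (leftAnd1 _ (toNNF-entails a)) (leftAnd2 _ (toNNF-entails b))
  toNNF-entails (a ∨ₜ b) = leftOr (rightOr1 _ (toNNF-entails a)) (rightOr2 _ (toNNF-entails b))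
  toNNF-entails (¬ₜ a)   =
    rightNot (swap (cut (toTerm (toNNF a)) (entails-toNNF a) (swap (dual-inconsistent (toNNF a)))))

oneSided : Ann → Maybe NNF
oneSided N     = nothing
oneSided (L t) = just (dual (toNNF t))
oneSided (R t) = just (toNNF t)

from-oneSided : ∀ g e → OL (asRight (oneSided g)) e → OL g e
from-oneSided N     e ⊢g = ⊢g
from-oneSided (R t) e ⊢g = swap (cut (toTerm (toNNF t)) (swap ⊢g) (toNNF-entails t))
from-oneSided (L t) e ⊢g =
  swap (cut (toTerm (toNNF (¬ₜ t))) (swap ⊢g)
             (cut (¬ₜ t) (toNNF-entails (¬ₜ t)) (leftNot (swap (hyp t)))))

meaning : Ann → NNF
meaning N     = top
meaning (L t) = toNNF t
meaning (R t) = dual (toNNF t)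

dual-meaning⇒oneSided : ∀ g r → CutFree (dual (meaning g)) r → CutFreeJoin (oneSided g) r
dual-meaning⇒oneSided N     r d = cut-admissible top (excluded-middle (pos 0)) d
dual-meaning⇒oneSided (L t) r d = d
dual-meaning⇒oneSided (R t) r d = subst (λ Z → CutFree Z r) (dual-involutive (toNNF t)) d

⊑⇒oneSided : ∀ g d → meaning g ⊑ dual (meaning d) → CutFreeJoin (oneSided g) (oneSided d)
⊑⇒oneSided g d ⟨ e ⟩ =
  join-comm (oneSided d) (oneSided g) (dual-meaning⇒oneSided d (oneSided g)
    (join-comm (oneSided g) (just (dual (meaning d))) (dual-meaning⇒oneSided g _ e)))

generic : ℕ → Canonical
generic p = [ pos p ]

⟦⟧-generic : ∀ t → ⌊ ⟦_⟧ Lindenbaum t generic ⌋ ≋ toNNF t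
⟦⟧-generic (var p)  = canon-≋ (pos p)
⟦⟧-generic (a ∧ₜ b) = canon-≋ _ ∙ ⊓-cong (⟦⟧-generic a) (⟦⟧-generic b)
⟦⟧-generic (a ∨ₜ b) = canon-≋ _ ∙ ⊔-cong (⟦⟧-generic a) (⟦⟧-generic b)
⟦⟧-generic (¬ₜ a)   = canon-≋ _ ∙ dual-cong (⟦⟧-generic a)

ι-generic : ∀ g → ⌊ ι Lindenbaum generic g ⌋ ≋ meaning g
ι-generic N     = canon-≋ top
ι-generic (L t) = ⟦⟧-generic t
ι-generic (R t) = canon-≋ _ ∙ dual-cong (⟦⟧-generic t)

≤⇒⊑ : ∀ a b → Ortholattice._≤_ Lindenbaum a b → ⌊ a ⌋ ⊑ ⌊ b ⌋
≤⇒⊑ a b a∧b≡a = ⊑-trans (proj₁ (≡⇒≋ (sym (cong ⌊_⌋ a∧b≡a)) ∙ canon-≋ (⌊ a ⌋ ⊓ ⌊ b ⌋))) ⊓⊑ʳ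

Lindenbaum-valid⇒⊑ : ∀ g d →
  Ortholattice._≤_ Lindenbaum (ι Lindenbaum generic g)
                              (Ortholattice.¬_ Lindenbaum (ι Lindenbaum generic d)) →
  meaning g ⊑ dual (meaning d)
Lindenbaum-valid⇒⊑ g d g≤¬d =
  ⊑-trans (proj₂ (ι-generic g))
    (⊑-trans (≤⇒⊑ ιg (Ortholattice.¬_ Lindenbaum ιd) g≤¬d)
             (proj₁ (canon-≋ (dual ⌊ ιd ⌋) ∙ dual-cong (ι-generic d))))
  where
  ιg ιd : Canonical
  ιg = ι Lindenbaum generic g
  ιd = ι Lindenbaum generic d

mainTheorem2 : (g d : Ann) →
    ((A : Ortholattice) → (v : ℕ → Ortholattice.Carrier A) →
      Ortholattice._≤_ A (ι A v g) (Ortholattice.¬_ A (ι A v d))) →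
    OL g d
mainTheorem2 g d valid = swap (from-oneSided d g (swap (from-oneSided g _ ⊢g,d)))
  where
  ⊢g,d : OL (asRight (oneSided g)) (asRight (oneSided d))
  ⊢g,d = CutFreeJoin⇒OL (oneSided g) (oneSided d)
           (⊑⇒oneSided g d (Lindenbaum-valid⇒⊑ g d (valid Lindenbaum generic)))
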